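{- Let $\mathbb A=(\{\mathsf P<\mathsf C<\mathsf S<\mathsf T<0\},\min,\max,0,\mathsf P)$ be the access control semiring. Let $\mathcal G=(V,V_0,V_1,T,E)$ be a finite acyclic game graph, $\sigma\in\{0,1\}$, and let $f_\sigma:T\to\mathbb A$ and $h_\sigma:E\to\mathbb A\setminus\{0\}$ be access levels, where a player with clearance level $c$ may use a move $e$ iff $h_\sigma(e)\le c$ and may access a terminal position $t$ iff $f_\sigma(t)\le c$. Then for every $v\in V$, the valuation $f_\sigma(v)\in\mathbb A$ is the minimal clearance level that Player $\sigma$ needs to win from $v$, i.e. the least $c$ (in the order $\mathsf P<\mathsf C<\mathsf S<\mathsf T<0$) such that Player $\sigma$ has a strategy from $v$ all of whose moves $e$ satisfy $h_\sigma(e)\le c$ and all of whose outcomes $t$ satisfy $f_\sigma(t)\le c$.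
   Context: A game graph is $\mathcal G=(V,V_0,V_1,T,E)$ where $V$ is the disjoint union of $V_0$ (positions of Player 0), $V_1$ (positions of Player 1) and $T$ (terminal positions), $E\subseteq V\times V$, $vE=\{w:(v,w)\in E\}$, $vE=\emptyset$ iff $v\in T$. The valuation $f_\sigma:V\to\mathbb A$ is defined by backward induction: $f_\sigma(v)=\sum_{w\in vE}h_\sigma(vw)\cdot f_\sigma(w)$ if $v\in V_\sigma$ and $f_\sigma(v)=\prod_{w\in vE}h_\sigma(vw)\cdot f_\sigma(w)$ if $v\in V_{1-\sigma}$, where in $\mathbb A$ the sum is $\min$ and the product is $\max$. ($\mathsf P$ = public, $\mathsf C$ = confidential, $\mathsf S$ = secret, $\mathsf T$ = top secret, $0$ = inaccessible.) A strategy of Player $\sigma$ from $v$ is a subtree of the tree unraveling from $v$ (tree of finite paths from $v$), containing the root, closed under prefixes, keeping exactly one successor at nodes ending in $V_\sigma$ and all successors at nodes ending in $V_{1-\sigma}$; its moves are the edges of $E$ corresponding to its tree edges, and its outcomes are the terminal positions where its plays end. -}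

module Defs where

open import Data.Nat using (ℕ; zero; suc; _≤_)
open import Data.Fin using (Fin)
open import Data.List using (List; []; _∷_; foldr; map)
open import Data.List.Membership.Propositional using (_∈_)
open import Data.List.Membership.Propositional using (mapWith∈)
open import Data.List.Relation.Unary.Any using (here; there)
open import Data.Product using (Σ; _×_; _,_)
open import Data.Unit using (⊤)
open import Relation.Binary.PropositionalEquality using (_≡_; _≢_)
open import Induction.WellFounded using (WellFounded; Acc; acc)

data 𝔸 : Set where
  𝖯 𝖢 𝖲 𝖳 𝟘 : 𝔸

rank : 𝔸 → ℕ
rank 𝖯 = 0
rank 𝖢 = 1
rank 𝖲 = 2
rank 𝖳 = 3
rank 𝟘 = 4

_≤𝔸_ : 𝔸 → 𝔸 → Set
a ≤𝔸 b = rank a ≤ rank b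

-- semiring sum = min
_⊕_ : 𝔸 → 𝔸 → 𝔸
𝖯 ⊕ b = 𝖯
𝖢 ⊕ 𝖯 = 𝖯
𝖢 ⊕ b = 𝖢
𝖲 ⊕ 𝖯 = 𝖯
𝖲 ⊕ 𝖢 = 𝖢
𝖲 ⊕ b = 𝖲
𝖳 ⊕ 𝟘 = 𝖳
𝖳 ⊕ b = b
𝟘 ⊕ b = b

-- semiring product = max
_⊗_ : 𝔸 → 𝔸 → 𝔸
𝖯 ⊗ b = b
𝖢 ⊗ 𝖯 = 𝖢
𝖢 ⊗ b = b
𝖲 ⊗ 𝖯 = 𝖲
𝖲 ⊗ 𝖢 = 𝖲
𝖲 ⊗ b = b
𝖳 ⊗ 𝟘 = 𝟘
𝖳 ⊗ b = 𝖳
𝟘 ⊗ b = 𝟘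

Σ𝔸 : List 𝔸 → 𝔸
Σ𝔸 = foldr _⊕_ 𝟘

Π𝔸 : List 𝔸 → 𝔸
Π𝔸 = foldr _⊗_ 𝖯

data Player : Set where
  P0 P1 : Player

sel : Player → Player → List 𝔸 → 𝔸
sel P0 P0 = Σ𝔸
sel P0 P1 = Π𝔸
sel P1 P0 = Π𝔸
sel P1 P1 = Σ𝔸

opp : Player → Player
opp P0 = P1
opp P1 = P0

data Kind : Set where
  owned : Player → Kind
  terminal : Kind

record GameGraph : Set where
  field
    n        : ℕ
    succ     : Fin n → List (Fin n)
    kind     : Fin n → Kind
    term⇒nil : ∀ v → kind v ≡ terminal → succ v ≡ []
    nil⇒term : ∀ v → succ v ≡ [] → kind v ≡ terminal

module _ (G : GameGraph) where
  open GameGraph G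

  Edge : Fin n → Fin n → Set
  Edge v w = w ∈ succ v

  -- acyclic (finite graph): there is no infinite path, i.e. the converse
  -- of E is well-founded (so that backward induction is well defined)
  Acyclic : Set
  Acyclic = WellFounded (λ w v → Edge v w)

  module Valuation (σ : Player) (f : Fin n → 𝔸) (h : Fin n → Fin n → 𝔸) where

    go : (v : Fin n) → Acc (λ w v → Edge v w) v → 𝔸
    go v (acc rs) with kind v
    ... | terminal = f v
    ... | owned τ  = sel σ τ (mapWith∈ (succ v) (λ {w} w∈ → h v w ⊗ go w (rs w∈)))

  valuation : Acyclic → (σ : Player) → (f : Fin n → 𝔸) → (h : Fin n → Fin n → 𝔸)
            → Fin n → 𝔸
  valuation acyc σ f h v = Valuation.go σ f h v (acyc v)

  -- Strategies of Player σ from v: subtrees of the unravelling of G from v,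
  -- choosing exactly one successor at positions of σ and keeping all
  -- successors at positions of the opponent.  (Since G is acyclic, these
  -- trees are finite, so an inductive type represents them.)
  data Strategy (σ : Player) : Fin n → Set where
    leaf : ∀ {v} → kind v ≡ terminal → Strategy σ v
    pick : ∀ {v} → kind v ≡ owned σ → (w : Fin n) → Edge v w
         → Strategy σ w → Strategy σ v
    every : ∀ {v} → kind v ≡ owned (opp σ)
          → ((w : Fin n) → Edge v w → Strategy σ w) → Strategy σ v

  AllMoves : ∀ {σ v} → (Fin n → Fin n → Set) → Strategy σ v → Set
  AllMoves P (leaf _) = ⊤
  AllMoves {v = v} P (pick _ w _ s) = P v w × AllMoves P s
  AllMoves {v = v} P (every _ k) = ∀ w (e : Edge v w) → P v w × AllMoves P (k w e)

  AllOutcomes : ∀ {σ v} → (Fin n → Set) → Strategy σ v → Set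
  AllOutcomes {v = v} Q (leaf _) = Q v
  AllOutcomes Q (pick _ w _ s) = AllOutcomes Q s
  AllOutcomes {v = v} Q (every _ k) = ∀ w (e : Edge v w) → AllOutcomes Q (k w e)

-- At a position of Player σ
-- the valuation is the minimum over the moves of (move level ⊔ successor
-- value), so a clearance c ≥ f_σ(v) affords some move together with a
-- strategy from its target; at a position of the opponent it is the maximum,
-- so c affords every move and a strategy from every target.  Conversely a
-- strategy within clearance c bounds the valuation by the same two facts,
-- read as lower-bound properties of min and max.
module Submission where

open import Defs
open import Data.Fin using (Fin)
open import Data.List using (List; []; _∷_)
open import Data.List.Membership.Propositional using (_∈_; mapWith∈)
open import Data.List.Relation.Unary.All using (All; []; _∷_)
open import Data.List.Relation.Unary.Any using (Any; here; there)
open import Data.List.Relation.Unary.Any.Properties using (mapWith∈⁺; mapWith∈⁻)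
open import Data.Nat using (_≤_; _⊓_; _⊔_; z≤n; s≤s)
open import Data.Nat.Properties
  using (≤-refl; ≤-trans; ⊓-sel; m≤n⇒m⊓o≤n; m≤n⇒o⊓m≤n; ⊔-lub; m⊔n≤o⇒m≤o; m⊔n≤o⇒n≤o)
open import Data.Product using (Σ; ∃₂; _×_; _,_; proj₁; proj₂)
open import Data.Sum using (_⊎_; inj₁; inj₂)
open import Data.Empty using (⊥-elim)
open import Data.Unit using (tt)
open import Function using (flip)
open import Induction.WellFounded using (Acc; acc)
open import Relation.Binary.PropositionalEquality using (_≡_; _≢_; refl; sym; trans; subst)

rank-⊕ : ∀ a b → rank (a ⊕ b) ≡ rank a ⊓ rank b
rank-⊕ 𝖯 _ = refl
rank-⊕ 𝖢 𝖯 = refl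
rank-⊕ 𝖢 𝖢 = refl
rank-⊕ 𝖢 𝖲 = refl
rank-⊕ 𝖢 𝖳 = refl
rank-⊕ 𝖢 𝟘 = refl
rank-⊕ 𝖲 𝖯 = refl
rank-⊕ 𝖲 𝖢 = refl
rank-⊕ 𝖲 𝖲 = refl
rank-⊕ 𝖲 𝖳 = refl
rank-⊕ 𝖲 𝟘 = refl
rank-⊕ 𝖳 𝖯 = refl
rank-⊕ 𝖳 𝖢 = refl
rank-⊕ 𝖳 𝖲 = refl
rank-⊕ 𝖳 𝖳 = refl
rank-⊕ 𝖳 𝟘 = refl
rank-⊕ 𝟘 𝖯 = refl
rank-⊕ 𝟘 𝖢 = refl
rank-⊕ 𝟘 𝖲 = refl
rank-⊕ 𝟘 𝖳 = refl
rank-⊕ 𝟘 𝟘 = refl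

rank-⊗ : ∀ a b → rank (a ⊗ b) ≡ rank a ⊔ rank b
rank-⊗ 𝖯 _ = refl
rank-⊗ 𝖢 𝖯 = refl
rank-⊗ 𝖢 𝖢 = refl
rank-⊗ 𝖢 𝖲 = refl
rank-⊗ 𝖢 𝖳 = refl
rank-⊗ 𝖢 𝟘 = refl
rank-⊗ 𝖲 𝖯 = refl
rank-⊗ 𝖲 𝖢 = refl
rank-⊗ 𝖲 𝖲 = refl
rank-⊗ 𝖲 𝖳 = refl
rank-⊗ 𝖲 𝟘 = refl
rank-⊗ 𝖳 𝖯 = refl
rank-⊗ 𝖳 𝖢 = refl
rank-⊗ 𝖳 𝖲 = refl
rank-⊗ 𝖳 𝖳 = refl
rank-⊗ 𝖳 𝟘 = refl
rank-⊗ 𝟘 𝖯 = refl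
rank-⊗ 𝟘 𝖢 = refl
rank-⊗ 𝟘 𝖲 = refl
rank-⊗ 𝟘 𝖳 = refl
rank-⊗ 𝟘 𝟘 = refl

≤𝔸-𝟘 : ∀ a → a ≤𝔸 𝟘
≤𝔸-𝟘 𝖯 = z≤n
≤𝔸-𝟘 𝖢 = s≤s z≤n
≤𝔸-𝟘 𝖲 = s≤s (s≤s z≤n)
≤𝔸-𝟘 𝖳 = s≤s (s≤s (s≤s z≤n))
≤𝔸-𝟘 𝟘 = ≤-refl

⊕-≤⁺ : ∀ {a b c} → a ≤𝔸 c ⊎ b ≤𝔸 c → (a ⊕ b) ≤𝔸 c
⊕-≤⁺ {a} {b} (inj₁ a≤c) rewrite rank-⊕ a b = m≤n⇒m⊓o≤n (rank b) a≤c
⊕-≤⁺ {a} {b} (inj₂ b≤c) rewrite rank-⊕ a b = m≤n⇒o⊓m≤n (rank a) b≤c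

⊕-≤⁻ : ∀ {a b c} → (a ⊕ b) ≤𝔸 c → a ≤𝔸 c ⊎ b ≤𝔸 c
⊕-≤⁻ {a} {b} {c} a⊕b≤c rewrite rank-⊕ a b with ⊓-sel (rank a) (rank b)
... | inj₁ ⊓≡a = inj₁ (subst (_≤ rank c) ⊓≡a a⊕b≤c)
... | inj₂ ⊓≡b = inj₂ (subst (_≤ rank c) ⊓≡b a⊕b≤c)

⊗-≤⁺ : ∀ {a b c} → a ≤𝔸 c → b ≤𝔸 c → (a ⊗ b) ≤𝔸 c
⊗-≤⁺ {a} {b} a≤c b≤c rewrite rank-⊗ a b = ⊔-lub a≤c b≤c

⊗-≤⁻ : ∀ {a b c} → (a ⊗ b) ≤𝔸 c → a ≤𝔸 c × b ≤𝔸 c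
⊗-≤⁻ {a} {b} a⊗b≤c rewrite rank-⊗ a b =
  m⊔n≤o⇒m≤o (rank a) (rank b) a⊗b≤c , m⊔n≤o⇒n≤o (rank a) (rank b) a⊗b≤c

Σ𝔸-≤⁺ : ∀ {xs c} → Any (_≤𝔸 c) xs → Σ𝔸 xs ≤𝔸 c
Σ𝔸-≤⁺ (here x≤c)   = ⊕-≤⁺ (inj₁ x≤c)
Σ𝔸-≤⁺ (there xs≤c) = ⊕-≤⁺ (inj₂ (Σ𝔸-≤⁺ xs≤c))

Σ𝔸-≤⁻ : ∀ {x xs c} → Σ𝔸 (x ∷ xs) ≤𝔸 c → Any (_≤𝔸 c) (x ∷ xs)
Σ𝔸-≤⁻ {x} {[]} Σ≤c with ⊕-≤⁻ Σ≤c
... | inj₁ x≤c = here x≤c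
... | inj₂ 𝟘≤c = here (≤-trans (≤𝔸-𝟘 x) 𝟘≤c)
Σ𝔸-≤⁻ {x} {_ ∷ _} Σ≤c with ⊕-≤⁻ Σ≤c
... | inj₁ x≤c  = here x≤c
... | inj₂ xs≤c = there (Σ𝔸-≤⁻ xs≤c)

Π𝔸-≤⁺ : ∀ {xs c} → All (_≤𝔸 c) xs → Π𝔸 xs ≤𝔸 c
Π𝔸-≤⁺ []            = z≤n
Π𝔸-≤⁺ (x≤c ∷ xs≤c) = ⊗-≤⁺ x≤c (Π𝔸-≤⁺ xs≤c)

Π𝔸-≤⁻ : ∀ {xs c} → Π𝔸 xs ≤𝔸 c → All (_≤𝔸 c) xs
Π𝔸-≤⁻ {[]}    _   = []
Π𝔸-≤⁻ {_ ∷ _} Π≤c = proj₁ (⊗-≤⁻ Π≤c) ∷ Π𝔸-≤⁻ (proj₂ (⊗-≤⁻ Π≤c))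

module _ {X : Set} {P : 𝔸 → Set} where

  All-mapWith∈⁺ : ∀ (xs : List X) {g : ∀ {x} → x ∈ xs → 𝔸}
                → (∀ {x} (x∈ : x ∈ xs) → P (g x∈)) → All P (mapWith∈ xs g)
  All-mapWith∈⁺ []       _  = []
  All-mapWith∈⁺ (_ ∷ xs) pg = pg (here refl) ∷ All-mapWith∈⁺ xs (λ x∈ → pg (there x∈))

  All-mapWith∈⁻ : ∀ (xs : List X) {g : ∀ {x} → x ∈ xs → 𝔸}
                → All P (mapWith∈ xs g) → ∀ {x} (x∈ : x ∈ xs) → P (g x∈)
  All-mapWith∈⁻ (_ ∷ _)  (pg ∷ _)   (here refl) = pg
  All-mapWith∈⁻ (_ ∷ xs) (_  ∷ pgs) (there x∈)  = All-mapWith∈⁻ xs pgs x∈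

Σ𝔸-mapWith∈-≤⁻ : ∀ {X : Set} (xs : List X) {g : ∀ {x} → x ∈ xs → 𝔸} {c} → xs ≢ []
               → Σ𝔸 (mapWith∈ xs g) ≤𝔸 c → ∃₂ λ x (x∈ : x ∈ xs) → g x∈ ≤𝔸 c
Σ𝔸-mapWith∈-≤⁻ []       xs≢[] _   = ⊥-elim (xs≢[] refl)
Σ𝔸-mapWith∈-≤⁻ (x ∷ xs) {g} _ Σ≤c = mapWith∈⁻ (x ∷ xs) g (Σ𝔸-≤⁻ Σ≤c)

data Turn (σ : Player) : Player → Set where
  own      : Turn σ σ
  opponent : Turn σ (opp σ)

turn : ∀ σ τ → Turn σ τ
turn P0 P0 = own
turn P0 P1 = opponent
turn P1 P0 = opponent
turn P1 P1 = own

sel-own : ∀ σ xs → sel σ σ xs ≡ Σ𝔸 xs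
sel-own P0 _ = refl
sel-own P1 _ = refl

sel-opponent : ∀ σ xs → sel σ (opp σ) xs ≡ Π𝔸 xs
sel-opponent P0 _ = refl
sel-opponent P1 _ = refl

module _ (G : GameGraph) (σ : Player) (f : Fin (GameGraph.n G) → 𝔸)
         (h : Fin (GameGraph.n G) → Fin (GameGraph.n G) → 𝔸) where
  open GameGraph G
  open Valuation G σ f h using (go)

  Affordable : 𝔸 → ∀ {v} → Strategy G σ v → Set
  Affordable c s = AllMoves G (λ a b → h a b ≤𝔸 c) s × AllOutcomes G (λ t → f t ≤𝔸 c) s

  moveValue : ∀ v → (∀ {w} → Edge G v w → Acc (flip (Edge G)) w) → ∀ {w} → Edge G v w → 𝔸
  moveValue v rs {w} w∈ = h v w ⊗ go w (rs w∈)

  owned⇒succ≢[] : ∀ {v τ} → kind v ≡ owned τ → succ v ≢ []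
  owned⇒succ≢[] {v} kv≡owned nil with trans (sym kv≡owned) (nil⇒term v nil)
  ... | ()

  pick-affordable : ∀ {v w c} → kind v ≡ owned σ → Edge G v w → h v w ≤𝔸 c
                  → Σ (Strategy G σ w) (Affordable c) → Σ (Strategy G σ v) (Affordable c)
  pick-affordable kv w∈ hvw≤c (s , moves , outcomes) = pick kv _ w∈ s , (hvw≤c , moves) , outcomes

  every-affordable : ∀ {v c} → kind v ≡ owned (opp σ)
                   → (∀ {w} → Edge G v w → h v w ≤𝔸 c × Σ (Strategy G σ w) (Affordable c))
                   → Σ (Strategy G σ v) (Affordable c)
  every-affordable kv branch =
    every kv (λ _ w∈ → proj₁ (proj₂ (branch w∈))) ,
    (λ _ w∈ → proj₁ (branch w∈) , proj₁ (proj₂ (proj₂ (branch w∈)))) ,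
    (λ _ w∈ → proj₂ (proj₂ (proj₂ (branch w∈))))

  affordable-strategy : ∀ {v} (a : Acc (flip (Edge G)) v) {c} → go v a ≤𝔸 c
                      → Σ (Strategy G σ v) (Affordable c)
  affordable-strategy {v} (acc rs) {c} val≤c with kind v in kv
  ... | terminal = leaf kv , tt , val≤c
  ... | owned τ with turn σ τ
  ...   | own =
    let w , w∈ , move≤c = Σ𝔸-mapWith∈-≤⁻ (succ v) (owned⇒succ≢[] kv)
                                          (subst (_≤𝔸 c) (sel-own σ _) val≤c)
        hvw≤c , valw≤c = ⊗-≤⁻ move≤c
    in pick-affordable kv w∈ hvw≤c (affordable-strategy (rs w∈) valw≤c)
  ...   | opponent = every-affordable kv branch
    where
    moves≤c : All (_≤𝔸 c) (mapWith∈ (succ v) (moveValue v rs))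
    moves≤c = Π𝔸-≤⁻ (subst (_≤𝔸 c) (sel-opponent σ _) val≤c)
    branch : ∀ {w} → Edge G v w → h v w ≤𝔸 c × Σ (Strategy G σ w) (Affordable c)
    branch w∈ = let hvw≤c , valw≤c = ⊗-≤⁻ (All-mapWith∈⁻ (succ v) moves≤c w∈)
                in hvw≤c , affordable-strategy (rs w∈) valw≤c

  valuation-≤-affordable : ∀ {v} (a : Acc (flip (Edge G)) v) {c} (s : Strategy G σ v)
                         → Affordable c s → go v a ≤𝔸 c
  valuation-≤-affordable (acc rs) (leaf kv) (_ , outcome) rewrite kv = outcome
  valuation-≤-affordable {v} (acc rs) (pick kv w w∈ s) ((hvw≤c , moves) , outcomes)
    rewrite kv | sel-own σ (mapWith∈ (succ v) (moveValue v rs)) =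
    Σ𝔸-≤⁺ (mapWith∈⁺ (moveValue v rs)
      (w , w∈ , ⊗-≤⁺ hvw≤c (valuation-≤-affordable (rs w∈) s (moves , outcomes))))
  valuation-≤-affordable {v} (acc rs) (every kv next) (moves , outcomes)
    rewrite kv | sel-opponent σ (mapWith∈ (succ v) (moveValue v rs)) =
    Π𝔸-≤⁺ (All-mapWith∈⁺ (succ v) λ {w} w∈ →
      ⊗-≤⁺ (proj₁ (moves w w∈))
           (valuation-≤-affordable (rs w∈) (next w w∈) (proj₂ (moves w w∈) , outcomes w w∈)))

mainTheorem5 : (G : GameGraph) → (acyc : Acyclic G) → (σ : Player)
    → (f : Fin (GameGraph.n G) → 𝔸)
    → (h : Fin (GameGraph.n G) → Fin (GameGraph.n G) → 𝔸)
    → (∀ v w → Edge G v w → h v w ≢ 𝟘)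
    → (v : Fin (GameGraph.n G))
    → (Σ (Strategy G σ v) λ s →
           AllMoves G (λ a b → h a b ≤𝔸 valuation G acyc σ f h v) s
         × AllOutcomes G (λ t → f t ≤𝔸 valuation G acyc σ f h v) s)
      × (∀ (c : 𝔸) → (s : Strategy G σ v)
           → AllMoves G (λ a b → h a b ≤𝔸 c) s
           → AllOutcomes G (λ t → f t ≤𝔸 c) s
           → valuation G acyc σ f h v ≤𝔸 c)
mainTheorem5 G acyc σ f h _ v =
  affordable-strategy G σ f h (acyc v) ≤-refl ,
  λ c s moves outcomes → valuation-≤-affordable G σ f h (acyc v) s (moves , outcomes)
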